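{- For every positive integer $n$, $p_{3,6}(n-3)$ equals the number of Garden of Eden partitions of $n$, i.e. the number of partitions of $n$ with rank $\leq -2$.
   Context: A partition of $n$ is a finite multiset of positive integers summing to $n$. The rank of a partition is its largest part minus its number of parts; Garden of Eden partitions of $n$ are those of rank $-2$ or less. For positive integers $A,a$ and a partition $\pi$, $\mathrm{mex}_{A,a}(\pi)$ is the smallest element of $\{a,a+A,a+2A,\dots\}$ that is not a part of $\pi$. $p_{A,a}(n)$ is the number of partitions $\pi$ of $n$ with $\mathrm{mex}_{A,a}(\pi)\equiv a \pmod{2A}$; by convention $p_{A,a}(0)=1$ and $p_{A,a}(m)=0$ for $m<0$. -}

module Defs where

open import Data.Nat using (ℕ; zero; suc; _+_; _*_; _∸_; _⊔_; _⊓_; _≤_; _≟_; _≤?_; NonZero)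
open import Data.Nat.Properties using (m*n≢0)
open import Data.Nat.DivMod using (_%_)
open import Data.Integer as ℤ using (ℤ; +_; -[1+_])
open import Data.List using (List; []; _∷_; length; sum; foldr; filter; concatMap; map; upTo)
open import Data.List.Membership.DecPropositional (_≟_) using (_∈?_)
open import Relation.Nullary using (Dec; yes; no; ¬_)
open import Relation.Nullary.Decidable using (¬?)
open import Relation.Binary.PropositionalEquality using (_≡_)

-- A partition is represented as a weakly decreasing list of positive integers.
-- partitionsBounded fuel n k : all partitions of n with all parts ≤ k
-- (each listed exactly once, parts in weakly decreasing order); fuel ≥ n suffices.
partitionsBounded : ℕ → ℕ → ℕ → List (List ℕ)
partitionsBounded _          zero    _ = [] ∷ []
partitionsBounded zero       (suc _) _ = []
partitionsBounded (suc fuel) (suc n) k =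
  concatMap (λ i → let j = suc i in map (j ∷_) (partitionsBounded fuel (suc n ∸ j) j))
            (upTo (k ⊓ suc n))

partitions : ℕ → List (List ℕ)
partitions n = partitionsBounded n n n

largestPart : List ℕ → ℕ
largestPart = foldr _⊔_ 0

rank : List ℕ → ℤ
rank π = + largestPart π ℤ.- + length π

isGardenOfEden : List ℕ → Set
isGardenOfEden π = rank π ℤ.≤ -[1+ 1 ]

isGardenOfEden? : (π : List ℕ) → Dec (isGardenOfEden π)
isGardenOfEden? π = rank π ℤ.≤? -[1+ 1 ]

gardenOfEdenCount : ℕ → ℕ
gardenOfEdenCount n = length (filter isGardenOfEden? (partitions n))

mexSearch : ℕ → ℕ → ℕ → List ℕ → ℕ
mexSearch zero       A c π = c
mexSearch (suc fuel) A c π with c ∈? π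
... | yes _ = mexSearch fuel A (c + A) π
... | no  _ = c

-- Since π has length π parts, one of the first (length π + 1) candidates
-- is missing, so fuel length π + 1 suffices (A > 0 makes candidates distinct).
mex : (A a : ℕ) → List ℕ → ℕ
mex A a π = mexSearch (suc (length π)) A a π

mexCond : (A a : ℕ) → .{{NonZero A}} → List ℕ → Set
mexCond A a π = let instance _ = m*n≢0 2 A in mex A a π % (2 * A) ≡ a % (2 * A)

mexCond? : (A a : ℕ) → .{{_ : NonZero A}} → (π : List ℕ) → Dec (mexCond A a π)
mexCond? A a π = let instance _ = m*n≢0 2 A in (mex A a π % (2 * A)) ≟ (a % (2 * A))

-- p_{A,a}(m) for an integer argument m; 0 for m < 0.
-- (For m = 0 the only partition is the empty one, whose mex is a, so the
--  count is 1, agreeing with the convention p_{A,a}(0) = 1.)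
pMex : (A a : ℕ) → .{{NonZero A}} → ℤ → ℕ
pMex A a (+ m)      = length (filter (mexCond? A a) (partitions m))
pMex A a -[1+ _ ]   = 0

-- Both sides obey the same recurrence. Write p_c(M) for the number of partitions of M whose
-- mex_{A,c} is ≡ c (mod 2A), and N_m(n) for the number of partitions of n of rank ≤ -m.
-- Partitions of c + M without a part c have mex c; deleting one part c from the others is a
-- bijection onto the partitions of M that turns mex_{A,c} into mex_{A,c+A} and so negates the
-- residue condition. Hence p_c(c + M) + p_{c+A}(M) = p(c + M), and p_c(M) = p(M) for M < c.
-- Deleting the largest part h of a partition of N of rank > -(m + 3) and adding a first column
-- of length h + m + 1 is a bijection onto the partitions of N + m + 1 of rank ≤ -m, so
-- N_m(N + m + 1) + N_{m+3}(N) = p(N), while N_{m+3}(N) = 0 for N ≤ m + 3. For A = 3, strong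
-- induction on M then gives p_{m+4}(M) = N_m(M + m + 1); the theorem is the case m = 2.

{-# OPTIONS --safe #-}
module Submission where

open import Defs
open import Data.Nat
open import Data.Nat.DivMod using (_%_; _/_; m≡m%n+[m/n]*n; [m+n]%n≡m%n)
open import Data.Nat.Divisibility using (_∣_; divides; ∣⇒≤; ∣m+n∣m⇒∣n; n∣m*n)
open import Data.Nat.Induction using (<-rec)
open import Data.Nat.ListAction using (sum)
open import Data.Nat.ListAction.Properties using (sum-++)
open import Data.Nat.Properties
open import Data.Nat.Tactic.RingSolver using (solve-∀)
open import Algebra.Properties.CommutativeSemigroup +-commutativeSemigroup using (x∙yz≈y∙xz; x∙yz≈yx∙z; xy∙z≈y∙xz; xy∙z≈zx∙y)
open import Data.Integer as ℤ using (+_; _-_; -[1+_]; _⊖_)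
import Data.Integer.Properties as ℤ
open import Data.List using (List; []; _∷_; length; map; filter; concatMap; upTo; replicate; drop; _++_)
open import Data.List.Membership.DecPropositional _≟_ using (_∈?_)
open import Data.List.Membership.Propositional using (_∈_; _∉_; find; lose)
open import Data.List.Membership.Propositional.Properties
open import Data.List.Membership.Propositional.Properties.WithK using (unique∧set⇒bag)
open import Data.List.Properties using (length-map; length-++; length-replicate; length-drop; map-∘; map-id-local; ∷-injectiveʳ; filter-all; filter-none; filter-≐)
open import Data.List.Relation.Binary.BagAndSetEquality using (∼bag⇒↭)
open import Data.List.Relation.Binary.Permutation.Propositional.Properties using (↭-length)
import Data.List.Relation.Unary.All as All
open import Data.List.Relation.Unary.Any using (here; there)
open import Data.List.Relation.Unary.Unique.Propositional using (Unique; []; _∷_)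
import Data.List.Relation.Unary.Unique.Propositional.Properties as Unique
open import Data.Product using (_×_; _,_; proj₁; proj₂; ∃-syntax)
open import Data.Sum as Sum using (_⊎_; inj₁; inj₂)
open import Function using (id; _∘_; _⇔_; mk⇔; Equivalence)
open import Level using (0ℓ)
open import Relation.Binary.PropositionalEquality
open import Relation.Nullary using (¬_; yes; no; contradiction)
open import Relation.Unary using (Pred; Decidable)
open import Relation.Unary.Properties using (∁?)

data Partition≤ : ℕ → List ℕ → Set where
  []   : ∀ {k} → Partition≤ k []
  cons : ∀ {k x xs} → 1 ≤ x → x ≤ k → Partition≤ x xs → Partition≤ k (x ∷ xs)

Partition≤-weaken : ∀ {k k′ π} → k ≤ k′ → Partition≤ k π → Partition≤ k′ π
Partition≤-weaken _    []             = []
Partition≤-weaken k≤k′ (cons 1≤x x≤k ρ) = cons 1≤x (≤-trans x≤k k≤k′) ρ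

Partition≤-sum : ∀ {k π} → Partition≤ k π → Partition≤ (sum π) π
Partition≤-sum []                         = []
Partition≤-sum {π = x ∷ xs} (cons 1≤x _ ρ) = cons 1≤x (m≤m+n x (sum xs)) ρ

Partition≤-∈ : ∀ {k π x} → Partition≤ k π → x ∈ π → x ≤ k
Partition≤-∈ (cons _ x≤k _) (here refl) = x≤k
Partition≤-∈ (cons _ x≤k ρ) (there y∈) = ≤-trans (Partition≤-∈ ρ y∈) x≤k

Partition≤-zero : ∀ {π} → Partition≤ 0 π → π ≡ []
Partition≤-zero []                   = refl
Partition≤-zero (cons (s≤s _) () _)

largestPart-≤ : ∀ {k π} → Partition≤ k π → largestPart π ≤ k
largestPart-≤ []             = z≤n
largestPart-≤ (cons _ x≤k ρ) = ⊔-lub x≤k (≤-trans (largestPart-≤ ρ) x≤k)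

largestPart-∷ : ∀ {k x xs} → Partition≤ k (x ∷ xs) → largestPart (x ∷ xs) ≡ x
largestPart-∷ (cons _ _ ρ) = m≥n⇒m⊔n≡m (largestPart-≤ ρ)

length≤sum : ∀ {k π} → Partition≤ k π → length π ≤ sum π
length≤sum []             = z≤n
length≤sum (cons 1≤x _ ρ) = +-mono-≤ 1≤x (length≤sum ρ)

Partition≤-largestPart : ∀ {k π} → Partition≤ k π → Partition≤ (largestPart π) π
Partition≤-largestPart []                  = []
Partition≤-largestPart π-ok@(cons 1≤x _ ρ) = cons 1≤x (≤-reflexive (sym (largestPart-∷ π-ok))) ρ

largestPart-positive : ∀ {k π} → Partition≤ k π → 0 < sum π → 0 < largestPart π
largestPart-positive []                  ()
largestPart-positive π-ok@(cons 1≤x _ _) _ = subst (0 <_) (sym (largestPart-∷ π-ok)) 1≤x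

∈-partitionsBounded⁻ : ∀ fuel n k {π} → n ≤ fuel → π ∈ partitionsBounded fuel n k →
                       Partition≤ k π × sum π ≡ n
∈-partitionsBounded⁻ fuel       zero    k n≤ (here refl) = [] , refl
∈-partitionsBounded⁻ zero       (suc n) k () _
∈-partitionsBounded⁻ (suc fuel) (suc n) k n≤ π∈
  with find (∈-concatMap⁻ _ {xs = upTo (k ⊓ suc n)} π∈)
... | i , i∈ , π∈ᵢ with ∈-applyUpTo⁻ id i∈ | ∈-map⁻ (suc i ∷_) π∈ᵢ
... | .i , i<k⊓1+n , refl | ρ , ρ∈ , refl
  with ∈-partitionsBounded⁻ fuel (n ∸ i) (suc i) (≤-trans (m∸n≤m n i) (s≤s⁻¹ n≤)) ρ∈
... | ρ-ok , Σρ =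
  cons (s≤s z≤n) (≤-trans i<k⊓1+n (m⊓n≤m k (suc n))) ρ-ok ,
  cong suc (trans (cong (_+_ i) Σρ) (m+[n∸m]≡n (s≤s⁻¹ (≤-trans i<k⊓1+n (m⊓n≤n k (suc n))))))

∈-partitionsBounded⁺ : ∀ fuel n k {π} → n ≤ fuel → Partition≤ k π → sum π ≡ n →
                       π ∈ partitionsBounded fuel n k
∈-partitionsBounded⁺ fuel       zero    k n≤ []                   _  = here refl
∈-partitionsBounded⁺ fuel       zero    k n≤ (cons (s≤s _) _ _)   ()
∈-partitionsBounded⁺ zero       (suc n) k () _                    _
∈-partitionsBounded⁺ (suc fuel) (suc n) k n≤ (cons {x = suc i} {xs = ρ} _ 1+i≤k ρ-ok) Σπ =
  ∈-concatMap⁺ _ (lose (∈-applyUpTo⁺ id (⊓-glb 1+i≤k (s≤s i≤n)))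
                       (∈-map⁺ (suc i ∷_)
                               (∈-partitionsBounded⁺ fuel (n ∸ i) (suc i) n∸i≤fuel ρ-ok Σρ)))
  where
  i+Σρ≡n : i + sum ρ ≡ n
  i+Σρ≡n = suc-injective Σπ
  i≤n : i ≤ n
  i≤n = subst (i ≤_) i+Σρ≡n (m≤m+n i (sum ρ))
  n∸i≤fuel : n ∸ i ≤ fuel
  n∸i≤fuel = ≤-trans (m∸n≤m n i) (s≤s⁻¹ n≤)
  Σρ : sum ρ ≡ n ∸ i
  Σρ = trans (sym (m+n∸m≡n i (sum ρ))) (cong (_∸ i) i+Σρ≡n)

unique-concatMap : {X Y : Set} (f : X → List Y) (key : Y → X) {xs : List X} → Unique xs →
                   (∀ x → Unique (f x)) → (∀ x {y} → y ∈ f x → key y ≡ x) →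
                   Unique (concatMap f xs)
unique-concatMap f key []           _     _   = []
unique-concatMap f key {x ∷ xs} (x∉xs ∷ xs!) f-uniq key-f =
  Unique.++⁺ (f-uniq x) (unique-concatMap f key xs! f-uniq key-f) disjoint
  where
  disjoint : ∀ {y} → ¬ (y ∈ f x × y ∈ concatMap f xs)
  disjoint (y∈fx , y∈rest) with find (∈-concatMap⁻ f {xs = xs} y∈rest)
  ... | x′ , x′∈xs , y∈fx′ =
    All.lookup x∉xs x′∈xs (trans (sym (key-f x y∈fx)) (key-f x′ y∈fx′))

partitionsBounded-unique : ∀ fuel n k → Unique (partitionsBounded fuel n k)
partitionsBounded-unique fuel       zero    k = All.[] ∷ []
partitionsBounded-unique zero       (suc n) k = []
partitionsBounded-unique (suc fuel) (suc n) k =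
  unique-concatMap _ (pred ∘ firstPart) (Unique.upTo⁺ (k ⊓ suc n))
    (λ i → Unique.map⁺ ∷-injectiveʳ (partitionsBounded-unique fuel (n ∸ i) (suc i)))
    firstPart-correct
  where
  firstPart : List ℕ → ℕ
  firstPart []      = 0
  firstPart (x ∷ _) = x
  firstPart-correct : ∀ i {π} → π ∈ map (suc i ∷_) (partitionsBounded fuel (n ∸ i) (suc i)) →
                      pred (firstPart π) ≡ i
  firstPart-correct i π∈ with ∈-map⁻ (suc i ∷_) π∈
  ... | _ , _ , refl = refl

partitionCount : ℕ → ℕ
partitionCount n = length (partitions n)

∈-partitions⁻ : ∀ {n π} → π ∈ partitions n → Partition≤ n π × sum π ≡ n
∈-partitions⁻ {n} = ∈-partitionsBounded⁻ n n n ≤-refl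

∈-partitions⁺ : ∀ {k n π} → Partition≤ k π → sum π ≡ n → π ∈ partitions n
∈-partitions⁺ {n = n} {π} π-ok Σπ =
  ∈-partitionsBounded⁺ n n n ≤-refl (subst (λ s → Partition≤ s π) Σπ (Partition≤-sum π-ok)) Σπ

partitions-unique : ∀ n → Unique (partitions n)
partitions-unique n = partitionsBounded-unique n n n

record InverseOn {X Y : Set} (xs : List X) (ys : List Y) : Set where
  field
    to      : X → Y
    from    : Y → X
    to-∈    : ∀ {x} → x ∈ xs → to x ∈ ys
    from-∈  : ∀ {y} → y ∈ ys → from y ∈ xs
    from∘to : ∀ {x} → x ∈ xs → from (to x) ≡ x
    to∘from : ∀ {y} → y ∈ ys → to (from y) ≡ y

module _ {X Y : Set} {xs : List X} {ys : List Y} where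

  InverseOn-length : Unique xs → Unique ys → InverseOn xs ys → length xs ≡ length ys
  InverseOn-length xs! ys! inv = begin
    length xs          ≡⟨ length-map to xs ⟨
    length (map to xs) ≡⟨ ↭-length (∼bag⇒↭ (unique∧set⇒bag to-xs! ys! (mk⇔ to-⊆ to-⊇))) ⟩
    length ys          ∎
    where
    open ≡-Reasoning
    open InverseOn inv
    to-xs! : Unique (map to xs)
    to-xs! = Unique.map⁻ {f = from}
      (subst Unique (sym (trans (sym (map-∘ xs)) (map-id-local (All.tabulate from∘to)))) xs!)
    to-⊆ : ∀ {y} → y ∈ map to xs → y ∈ ys
    to-⊆ y∈ with ∈-map⁻ to y∈
    ... | x , x∈xs , refl = to-∈ x∈xs
    to-⊇ : ∀ {y} → y ∈ ys → y ∈ map to xs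
    to-⊇ y∈ys = subst (_∈ map to xs) (to∘from y∈ys) (∈-map⁺ to (from-∈ y∈ys))

  InverseOn-filter : {P : Pred X 0ℓ} {Q : Pred Y 0ℓ} (P? : Decidable P) (Q? : Decidable Q) →
                     (inv : InverseOn xs ys) → (∀ {x} → x ∈ xs → P x ⇔ Q (InverseOn.to inv x)) →
                     InverseOn (filter P? xs) (filter Q? ys)
  InverseOn-filter {Q = Q} P? Q? inv P⇔Q = record
    { to      = to
    ; from    = from
    ; to-∈    = λ x∈ → let x∈xs , Px = ∈-filter⁻ P? x∈ in
                  ∈-filter⁺ Q? (to-∈ x∈xs) (Equivalence.to (P⇔Q x∈xs) Px)
    ; from-∈  = λ y∈ → let y∈ys , Qy = ∈-filter⁻ Q? y∈ in
                  ∈-filter⁺ P? (from-∈ y∈ys)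
                    (Equivalence.from (P⇔Q (from-∈ y∈ys)) (subst Q (sym (to∘from y∈ys)) Qy))
    ; from∘to = λ x∈ → from∘to (proj₁ (∈-filter⁻ P? x∈))
    ; to∘from = λ y∈ → to∘from (proj₁ (∈-filter⁻ Q? y∈))
    }
    where open InverseOn inv

module _ {X : Set} {P : Pred X 0ℓ} (P? : Decidable P) where

  length≡filter+filter∁ : ∀ xs → length xs ≡ length (filter P? xs) + length (filter (∁? P?) xs)
  length≡filter+filter∁ []       = refl
  length≡filter+filter∁ (x ∷ xs) with P? x
  ... | yes _ = cong suc (length≡filter+filter∁ xs)
  ... | no  _ = trans (cong suc (length≡filter+filter∁ xs)) (sym (+-suc _ _))

  length-filter-split : {Q : Pred X 0ℓ} (Q? : Decidable Q) → ∀ xs →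
                        length (filter P? xs) ≡
                        length (filter P? (filter Q? xs)) + length (filter P? (filter (∁? Q?) xs))
  length-filter-split Q? []       = refl
  length-filter-split Q? (x ∷ xs) with Q? x
  ... | yes _ with P? x
  ...   | yes _ = cong suc (length-filter-split Q? xs)
  ...   | no  _ = length-filter-split Q? xs
  length-filter-split Q? (x ∷ xs) | no _ with P? x
  ...   | yes _ = trans (cong suc (length-filter-split Q? xs)) (sym (+-suc _ _))
  ...   | no  _ = length-filter-split Q? xs

insertPart : ℕ → List ℕ → List ℕ
insertPart c []       = c ∷ []
insertPart c (x ∷ xs) with x ≤? c
... | yes _ = c ∷ x ∷ xs
... | no  _ = x ∷ insertPart c xs

removePart : ℕ → List ℕ → List ℕ
removePart c []       = []
removePart c (x ∷ xs) with x ≟ c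
... | yes _ = xs
... | no  _ = x ∷ removePart c xs

insertPart-Partition≤ : ∀ {k c σ} → 1 ≤ c → c ≤ k → Partition≤ k σ →
                        Partition≤ k (insertPart c σ)
insertPart-Partition≤ 1≤c c≤k [] = cons 1≤c c≤k []
insertPart-Partition≤ {c = c} 1≤c c≤k (cons {x = x} 1≤x x≤k ρ) with x ≤? c
... | yes x≤c = cons 1≤c c≤k (cons 1≤x x≤c ρ)
... | no  x≰c = cons 1≤x x≤k (insertPart-Partition≤ 1≤c (<⇒≤ (≰⇒> x≰c)) ρ)

sum-insertPart : ∀ c σ → sum (insertPart c σ) ≡ c + sum σ
sum-insertPart c []       = refl
sum-insertPart c (x ∷ xs) with x ≤? c
... | yes _ = refl
... | no  _ = trans (cong (_+_ x) (sum-insertPart c xs)) (x∙yz≈y∙xz x c (sum xs))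

∈-insertPart : ∀ c σ → c ∈ insertPart c σ
∈-insertPart c []       = here refl
∈-insertPart c (x ∷ xs) with x ≤? c
... | yes _ = here refl
... | no  _ = there (∈-insertPart c xs)

removePart-head : ∀ c xs → removePart c (c ∷ xs) ≡ xs
removePart-head c xs with c ≟ c
... | yes _   = refl
... | no c≢c = contradiction refl c≢c

removePart-insertPart : ∀ c σ → removePart c (insertPart c σ) ≡ σ
removePart-insertPart c []       = removePart-head c []
removePart-insertPart c (x ∷ xs) with x ≤? c
... | yes _ = removePart-head c (x ∷ xs)
... | no x≰c with x ≟ c
...   | yes refl = contradiction ≤-refl x≰c
...   | no  _    = cong (x ∷_) (removePart-insertPart c xs)

insertPart-head : ∀ {x xs} → Partition≤ x xs → insertPart x xs ≡ x ∷ xs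
insertPart-head [] = refl
insertPart-head {x} (cons {x = y} _ y≤x _) with y ≤? x
... | yes _   = refl
... | no y≰x = contradiction y≤x y≰x

insertPart-removePart : ∀ {k c π} → Partition≤ k π → c ∈ π → insertPart c (removePart c π) ≡ π
insertPart-removePart {c = c} (cons {x = x} _ _ ρ) c∈ with x ≟ c
... | yes refl = insertPart-head ρ
insertPart-removePart (cons _ _ ρ) (here refl) | no x≢c = contradiction refl x≢c
insertPart-removePart {c = c} (cons {x = x} _ _ ρ) (there c∈xs) | no x≢c with x ≤? c
... | yes x≤c = contradiction (≤-antisym x≤c (Partition≤-∈ ρ c∈xs)) x≢c
... | no  _   = cong (x ∷_) (insertPart-removePart ρ c∈xs)

removePart-Partition≤ : ∀ {k c π} → Partition≤ k π → Partition≤ k (removePart c π)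
removePart-Partition≤ [] = []
removePart-Partition≤ {c = c} (cons {x = x} 1≤x x≤k ρ) with x ≟ c
... | yes _ = Partition≤-weaken x≤k ρ
... | no  _ = cons 1≤x x≤k (removePart-Partition≤ ρ)

sum-removePart : ∀ {c π} → c ∈ π → c + sum (removePart c π) ≡ sum π
sum-removePart {c} {x ∷ xs} c∈ with x ≟ c
... | yes refl = refl
sum-removePart (here refl)      | no x≢c = contradiction refl x≢c
sum-removePart {c} {x ∷ xs} (there c∈xs) | no _ =
  trans (x∙yz≈y∙xz c x _) (cong (_+_ x) (sum-removePart c∈xs))

length-removePart : ∀ {c π} → c ∈ π → suc (length (removePart c π)) ≡ length π
length-removePart {c} {x ∷ xs} c∈ with x ≟ c
... | yes refl = refl
length-removePart (here refl)      | no x≢c = contradiction refl x≢c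
length-removePart (there c∈xs)     | no _   = cong suc (length-removePart c∈xs)

∈-removePart⁺ : ∀ {c π y} → y ≢ c → y ∈ π → y ∈ removePart c π
∈-removePart⁺ {c} {x ∷ xs} y≢c y∈ with x ≟ c
∈-removePart⁺ y≢c (here refl)  | yes refl = contradiction refl y≢c
∈-removePart⁺ y≢c (there y∈xs) | yes refl = y∈xs
∈-removePart⁺ y≢c (here refl)  | no _     = here refl
∈-removePart⁺ y≢c (there y∈xs) | no _     = there (∈-removePart⁺ y≢c y∈xs)

∈-removePart⁻ : ∀ {c π y} → y ∈ removePart c π → y ∈ π
∈-removePart⁻ {c} {x ∷ xs} y∈ with x ≟ c
... | yes _ = there y∈
∈-removePart⁻ (here refl)  | no _ = here refl
∈-removePart⁻ (there y∈xs) | no _ = there (∈-removePart⁻ y∈xs)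

insertPart-InverseOn : ∀ c M → 1 ≤ c → InverseOn (partitions M) (filter (c ∈?_) (partitions (c + M)))
insertPart-InverseOn c M 1≤c = record
  { to      = insertPart c
  ; from    = removePart c
  ; to-∈    = λ {σ} σ∈ → let σ-ok , Σσ = ∈-partitions⁻ σ∈ in
      ∈-filter⁺ (c ∈?_)
        (∈-partitions⁺ (insertPart-Partition≤ 1≤c (m≤m+n c M) (Partition≤-weaken (m≤n+m M c) σ-ok))
                       (trans (sum-insertPart c σ) (cong (_+_ c) Σσ)))
        (∈-insertPart c σ)
  ; from-∈  = λ π∈ → let π∈L , c∈π = ∈-filter⁻ (c ∈?_) π∈
                         π-ok , Σπ = ∈-partitions⁻ {c + M} π∈L in
      ∈-partitions⁺ (removePart-Partition≤ π-ok) (+-cancelˡ-≡ c _ _ (trans (sum-removePart c∈π) Σπ))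
  ; from∘to = λ {σ} _ → removePart-insertPart c σ
  ; to∘from = λ π∈ → let π∈L , c∈π = ∈-filter⁻ (c ∈?_) π∈ in
      insertPart-removePart (proj₁ (∈-partitions⁻ {c + M} π∈L)) c∈π
  }

module _ (n : ℕ) .{{_ : NonZero n}} where
  private instance
    2n≢0 : NonZero (2 * n)
    2n≢0 = m*n≢0 2 n

  [m+n]%[2*n]≢m%[2*n] : ∀ m → (m + n) % (2 * n) ≢ m % (2 * n)
  [m+n]%[2*n]≢m%[2*n] m eq = <⇒≱ n<2n (∣⇒≤ 2n∣n)
    where
    n<2n : n < 2 * n
    n<2n = subst (n <_) (cong (_+_ n) (sym (+-identityʳ n))) (m<m+n n (>-nonZero⁻¹ n))
    shift-quotients : (m / (2 * n)) * (2 * n) + n ≡ ((m + n) / (2 * n)) * (2 * n)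
    shift-quotients = +-cancelˡ-≡ (m % (2 * n)) _ _ (begin
      m % (2 * n) + ((m / (2 * n)) * (2 * n) + n) ≡⟨ +-assoc (m % (2 * n)) _ n ⟨
      m % (2 * n) + (m / (2 * n)) * (2 * n) + n   ≡⟨ cong (_+ n) (m≡m%n+[m/n]*n m (2 * n)) ⟨
      m + n                                        ≡⟨ m≡m%n+[m/n]*n (m + n) (2 * n) ⟩
      (m + n) % (2 * n) + ((m + n) / (2 * n)) * (2 * n) ≡⟨ cong (_+ ((m + n) / (2 * n)) * (2 * n)) eq ⟩
      m % (2 * n) + ((m + n) / (2 * n)) * (2 * n) ∎)
      where open ≡-Reasoning
    2n∣n : 2 * n ∣ n
    2n∣n = ∣m+n∣m⇒∣n (divides ((m + n) / (2 * n)) shift-quotients) (n∣m*n (m / (2 * n)))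

  [m+kn]%[2*n]-alternates : ∀ m k → (m + k * n) % (2 * n) ≡ m % (2 * n)
                                   ⊎ (m + k * n) % (2 * n) ≡ (m + n) % (2 * n)
  [m+kn]%[2*n]-alternates m zero          = inj₁ (cong (_% (2 * n)) (+-identityʳ m))
  [m+kn]%[2*n]-alternates m (suc zero)    = inj₂ (cong (λ t → (m + t) % (2 * n)) (+-identityʳ n))
  [m+kn]%[2*n]-alternates m (suc (suc k)) =
    Sum.map (trans two-more) (trans two-more) ([m+kn]%[2*n]-alternates m k)
    where
    two-more : (m + (2 + k) * n) % (2 * n) ≡ (m + k * n) % (2 * n)
    two-more = trans (cong (_% (2 * n)) (regroup m k n)) ([m+n]%n≡m%n (m + k * n) (2 * n))
      where
      regroup : ∀ m k n → m + (2 + k) * n ≡ m + k * n + 2 * n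
      regroup = solve-∀

mexSearch-cong : ∀ fuel A d {π π′} →
                 (∀ {x} → d ≤ x → x ∈ π → x ∈ π′) →
                 (∀ {x} → d ≤ x → x ∈ π′ → x ∈ π) →
                 mexSearch fuel A d π ≡ mexSearch fuel A d π′
mexSearch-cong zero       A d _ _ = refl
mexSearch-cong (suc fuel) A d {π} {π′} π⊆π′ π′⊆π with d ∈? π | d ∈? π′
... | yes _   | yes _    = mexSearch-cong fuel A (d + A) (π⊆π′ ∘ d+A≤) (π′⊆π ∘ d+A≤)
  where
  d+A≤ : ∀ {x} → d + A ≤ x → d ≤ x
  d+A≤ = ≤-trans (m≤m+n d A)
... | yes d∈π | no  d∉π′ = contradiction (π⊆π′ ≤-refl d∈π) d∉π′
... | no  d∉π | yes d∈π′ = contradiction (π′⊆π ≤-refl d∈π′) d∉π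
... | no  _   | no  _    = refl

mexSearch-offset : ∀ fuel A d π → ∃[ k ] mexSearch fuel A d π ≡ d + k * A
mexSearch-offset zero       A d π = 0 , sym (+-identityʳ d)
mexSearch-offset (suc fuel) A d π with d ∈? π
... | no  _ = 0 , sym (+-identityʳ d)
... | yes _ with mexSearch-offset fuel A (d + A) π
...   | k , eq = suc k , trans eq (+-assoc d A (k * A))

mex-∉ : ∀ A {c π} → c ∉ π → mex A c π ≡ c
mex-∉ A {c} {π} c∉π with c ∈? π
... | yes c∈π = contradiction c∈π c∉π
... | no  _   = refl

mex-removePart : ∀ A .{{_ : NonZero A}} {c π} → c ∈ π → mex A c π ≡ mex A (c + A) (removePart c π)
mex-removePart A {c} {π} c∈π with c ∈? π
... | no c∉π = contradiction c∈π c∉π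
... | yes _  = begin
  mexSearch (length π) A (c + A) π
    ≡⟨ mexSearch-cong (length π) A (c + A) (∈-removePart⁺ ∘ above) (λ _ → ∈-removePart⁻) ⟩
  mexSearch (length π) A (c + A) (removePart c π)
    ≡⟨ cong (λ fuel → mexSearch fuel A (c + A) (removePart c π)) (length-removePart c∈π) ⟨
  mex A (c + A) (removePart c π) ∎
  where
  open ≡-Reasoning
  above : ∀ {x} → c + A ≤ x → x ≢ c
  above c+A≤c refl = <⇒≱ (m<m+n c (>-nonZero⁻¹ A)) c+A≤c

module _ (A : ℕ) .{{_ : NonZero A}} where
  private instance
    2A≢0 : NonZero (2 * A)
    2A≢0 = m*n≢0 2 A

  mexCond-flip : ∀ {c π σ} → mex A c π ≡ mex A (c + A) σ → (¬ mexCond A (c + A) σ) ⇔ mexCond A c π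
  mexCond-flip {c} {π} {σ} mex≡ = mk⇔ backward forward
    where
    open ≡-Reasoning
    forward : mexCond A c π → ¬ mexCond A (c + A) σ
    forward condπ condσ = [m+n]%[2*n]≢m%[2*n] A c (begin
      (c + A) % (2 * A)         ≡⟨ condσ ⟨
      mex A (c + A) σ % (2 * A) ≡⟨ cong (_% (2 * A)) mex≡ ⟨
      mex A c π % (2 * A)       ≡⟨ condπ ⟩
      c % (2 * A)               ∎)
    backward : ¬ mexCond A (c + A) σ → mexCond A c π
    backward ¬condσ with mexSearch-offset (suc (length σ)) A (c + A) σ
    ... | k , mex≡c+A+kA with [m+kn]%[2*n]-alternates A (c + A) k
    ...   | inj₁ stays = contradiction (trans (cong (_% (2 * A)) mex≡c+A+kA) stays) ¬condσ
    ...   | inj₂ moves = begin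
      mex A c π % (2 * A)       ≡⟨ cong (_% (2 * A)) (trans mex≡ mex≡c+A+kA) ⟩
      (c + A + k * A) % (2 * A) ≡⟨ moves ⟩
      (c + A + A) % (2 * A)     ≡⟨ cong (_% (2 * A)) (c+A+A≡c+2A c A) ⟩
      (c + 2 * A) % (2 * A)     ≡⟨ [m+n]%n≡m%n c (2 * A) ⟩
      c % (2 * A)               ∎
      where
      c+A+A≡c+2A : ∀ c A → c + A + A ≡ c + 2 * A
      c+A+A≡c+2A = solve-∀

  pMex-below : ∀ c M → M < c → pMex A c (+ M) ≡ partitionCount M
  pMex-below c M M<c = cong length (filter-all (mexCond? A c) (All.tabulate mex≡c))
    where
    mex≡c : ∀ {π} → π ∈ partitions M → mexCond A c π
    mex≡c π∈ = cong (_% (2 * A))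
      (mex-∉ A (λ c∈π → <⇒≱ M<c (Partition≤-∈ (proj₁ (∈-partitions⁻ π∈)) c∈π)))

  pMex-recurrence : ∀ c M → 1 ≤ c →
                    pMex A c (+ (c + M)) + pMex A (c + A) (+ M) ≡ partitionCount (c + M)
  pMex-recurrence c M 1≤c = begin
    #cond L + #cond′
      ≡⟨ cong (_+ #cond′) (length-filter-split (mexCond? A c) (c ∈?_) L) ⟩
    (#cond with-c + #cond without-c) + #cond′
      ≡⟨ cong₂ (λ a b → a + b + #cond′) with-c-count without-c-count ⟩
    (#¬cond′ + length without-c) + #cond′
      ≡⟨ xy∙z≈zx∙y #¬cond′ (length without-c) #cond′ ⟩
    (#cond′ + #¬cond′) + length without-c
      ≡⟨ cong (_+ length without-c) (length≡filter+filter∁ (mexCond? A (c + A)) (partitions M)) ⟨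
    partitionCount M + length without-c
      ≡⟨ cong (_+ length without-c) (InverseOn-length (partitions-unique M) with-c! inv) ⟩
    length with-c + length without-c
      ≡⟨ length≡filter+filter∁ (c ∈?_) L ⟨
    partitionCount (c + M) ∎
    where
    open ≡-Reasoning
    L with-c without-c : List (List ℕ)
    L         = partitions (c + M)
    with-c    = filter (c ∈?_) L
    without-c = filter (∁? (c ∈?_)) L
    with-c! : Unique with-c
    with-c! = Unique.filter⁺ (c ∈?_) (partitions-unique (c + M))
    #cond : List (List ℕ) → ℕ
    #cond = length ∘ filter (mexCond? A c)
    #cond′ #¬cond′ : ℕ
    #cond′  = pMex A (c + A) (+ M)
    #¬cond′ = length (filter (∁? (mexCond? A (c + A))) (partitions M))
    inv : InverseOn (partitions M) with-c
    inv = insertPart-InverseOn c M 1≤c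
    with-c-count : #cond with-c ≡ #¬cond′
    with-c-count = sym (InverseOn-length
      (Unique.filter⁺ _ (partitions-unique M)) (Unique.filter⁺ _ with-c!)
      (InverseOn-filter (∁? (mexCond? A (c + A))) (mexCond? A c) inv λ {σ} _ →
        mexCond-flip {c} {insertPart c σ} {σ}
          (trans (mex-removePart A (∈-insertPart c σ)) (cong (mex A (c + A)) (removePart-insertPart c σ)))))
    without-c-count : #cond without-c ≡ length without-c
    without-c-count = cong length (filter-all (mexCond? A c) (All.tabulate λ π∈ →
      cong (_% (2 * A)) (mex-∉ A (proj₂ (∈-filter⁻ (∁? (c ∈?_)) {xs = L} π∈)))))

RankAtMostMinus : ℕ → List ℕ → Set
RankAtMostMinus m π = largestPart π + m ≤ length π

rankAtMostMinus? : ∀ m → Decidable (RankAtMostMinus m)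
rankAtMostMinus? m π = largestPart π + m ≤? length π

rankAtMostMinusCount : ℕ → ℕ → ℕ
rankAtMostMinusCount m n = length (filter (rankAtMostMinus? m) (partitions n))

m⊖n≤-[1+k]⇔m+1+k≤n : ∀ k m n → m ⊖ n ℤ.≤ -[1+ k ] ⇔ m + suc k ≤ n
m⊖n≤-[1+k]⇔m+1+k≤n k m n = mk⇔ (to m n) (from m n)
  where
  to : ∀ m n → m ⊖ n ℤ.≤ -[1+ k ] → m + suc k ≤ n
  to zero    (suc n) (ℤ.-≤- k≤n) = s≤s k≤n
  to (suc m) (suc n) le = s≤s (to m n (subst (ℤ._≤ -[1+ k ]) (ℤ.[1+m]⊖[1+n]≡m⊖n m n) le))
  from : ∀ m n → m + suc k ≤ n → m ⊖ n ℤ.≤ -[1+ k ]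
  from zero    (suc n) (s≤s k≤n) = ℤ.-≤- k≤n
  from (suc m) (suc n) (s≤s le) = subst (ℤ._≤ -[1+ k ]) (sym (ℤ.[1+m]⊖[1+n]≡m⊖n m n)) (from m n le)

gardenOfEdenCount≡rankAtMostMinusCount : ∀ n → gardenOfEdenCount n ≡ rankAtMostMinusCount 2 n
gardenOfEdenCount≡rankAtMostMinusCount n =
  cong length (filter-≐ isGardenOfEden? (rankAtMostMinus? 2)
                        ((λ {π} → Equivalence.to (rank⇔ π)) , λ {π} → Equivalence.from (rank⇔ π))
                        (partitions n))
  where
  rank⇔ : ∀ π → isGardenOfEden π ⇔ RankAtMostMinus 2 π
  rank⇔ π = subst (λ r → (r ℤ.≤ -[1+ 1 ]) ⇔ RankAtMostMinus 2 π)
                  (sym (ℤ.m-n≡m⊖n (largestPart π) (length π)))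
                  (m⊖n≤-[1+k]⇔m+1+k≤n 1 (largestPart π) (length π))

rankAtMostMinusCount-vanishes : ∀ m n → n ≤ suc m → rankAtMostMinusCount (suc m) n ≡ 0
rankAtMostMinusCount-vanishes m n n≤1+m =
  cong length (filter-none (rankAtMostMinus? (suc m)) (All.tabulate not-low-rank))
  where
  not-low-rank : ∀ {π} → π ∈ partitions n → ¬ RankAtMostMinus (suc m) π
  not-low-rank {[]}     _  ()
  not-low-rank {x ∷ xs} π∈ low-rank with ∈-partitions⁻ π∈
  ... | π-ok@(cons 1≤x _ _) , Σπ = 1+n≰n (begin
    suc (suc m)              ≤⟨ +-monoˡ-≤ (suc m) (subst (1 ≤_) (sym (largestPart-∷ π-ok)) 1≤x) ⟩
    largestPart π + suc m    ≤⟨ low-rank ⟩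
    length π                 ≤⟨ length≤sum π-ok ⟩
    sum π                    ≡⟨ Σπ ⟩
    n                        ≤⟨ n≤1+m ⟩
    suc m                    ∎)
    where
    open ≤-Reasoning
    π : List ℕ
    π = x ∷ xs

removeFirstColumn : List ℕ → List ℕ
removeFirstColumn []                 = []
removeFirstColumn (zero ∷ xs)        = removeFirstColumn xs
removeFirstColumn (suc zero ∷ xs)    = removeFirstColumn xs
removeFirstColumn (suc (suc x) ∷ xs) = suc x ∷ removeFirstColumn xs

countOnes : List ℕ → ℕ
countOnes []                 = 0
countOnes (zero ∷ xs)        = countOnes xs
countOnes (suc zero ∷ xs)    = suc (countOnes xs)
countOnes (suc (suc _) ∷ xs) = countOnes xs

removeFirstColumn-Partition≤ : ∀ {k μ} → Partition≤ k μ → Partition≤ (pred k) (removeFirstColumn μ)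
removeFirstColumn-Partition≤ [] = []
removeFirstColumn-Partition≤ (cons {x = suc zero} _ _ ρ) =
  Partition≤-weaken z≤n (removeFirstColumn-Partition≤ ρ)
removeFirstColumn-Partition≤ (cons {x = suc (suc x)} _ 2+x≤k ρ) =
  cons (s≤s z≤n) (pred-mono-≤ 2+x≤k) (removeFirstColumn-Partition≤ ρ)

addFirstColumn : ℕ → List ℕ → List ℕ
addFirstColumn extra u = map suc u ++ replicate extra 1

first-column-decomposition : ∀ {k μ} → Partition≤ k μ →
                             μ ≡ addFirstColumn (countOnes μ) (removeFirstColumn μ)
first-column-decomposition [] = refl
first-column-decomposition (cons {x = suc zero} {xs} _ _ ρ)
  with removeFirstColumn xs | first-column-decomposition ρ | Partition≤-zero (removeFirstColumn-Partition≤ ρ)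
... | .[] | xs≡ones | refl = cong (1 ∷_) xs≡ones
first-column-decomposition (cons {x = suc (suc x)} _ _ ρ) =
  cong (suc (suc x) ∷_) (first-column-decomposition ρ)

length-addFirstColumn : ∀ extra u → length (addFirstColumn extra u) ≡ length u + extra
length-addFirstColumn extra u =
  trans (length-++ (map suc u)) (cong₂ _+_ (length-map suc u) (length-replicate extra))

sum-addFirstColumn : ∀ extra u → sum (addFirstColumn extra u) ≡ length u + sum u + extra
sum-addFirstColumn extra u = trans (sum-++ (map suc u) _) (cong₂ _+_ (sum-map-suc u) (sum-ones extra))
  where
  sum-map-suc : ∀ u → sum (map suc u) ≡ length u + sum u
  sum-map-suc []       = refl
  sum-map-suc (x ∷ xs) =
    cong suc (trans (cong (_+_ x) (sum-map-suc xs)) (x∙yz≈y∙xz x (length xs) (sum xs)))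
  sum-ones : ∀ r → sum (replicate r 1) ≡ r
  sum-ones zero    = refl
  sum-ones (suc r) = cong suc (sum-ones r)

addFirstColumn-Partition≤ : ∀ {k u} extra → Partition≤ k u →
                            Partition≤ (suc k) (addFirstColumn extra u)
addFirstColumn-Partition≤ extra []             = Partition≤-weaken (s≤s z≤n) (ones extra)
  where
  ones : ∀ r → Partition≤ 1 (replicate r 1)
  ones zero    = []
  ones (suc r) = cons ≤-refl ≤-refl (ones r)
addFirstColumn-Partition≤ extra (cons _ x≤k ρ) =
  cons (s≤s z≤n) (s≤s x≤k) (addFirstColumn-Partition≤ extra ρ)

removeFirstColumn-addFirstColumn : ∀ {k u} extra → Partition≤ k u →
                                   removeFirstColumn (addFirstColumn extra u) ≡ u
removeFirstColumn-addFirstColumn extra [] = ones extra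
  where
  ones : ∀ r → removeFirstColumn (replicate r 1) ≡ []
  ones zero    = refl
  ones (suc r) = ones r
removeFirstColumn-addFirstColumn extra (cons {x = suc x} _ _ ρ) =
  cong (suc x ∷_) (removeFirstColumn-addFirstColumn extra ρ)

infixr 5 _∷₊_
_∷₊_ : ℕ → List ℕ → List ℕ
zero  ∷₊ u = []
suc a ∷₊ u = suc a ∷ u

∷₊-Partition≤ : ∀ {a u} → Partition≤ a u → Partition≤ a (a ∷₊ u)
∷₊-Partition≤ {zero}  _    = []
∷₊-Partition≤ {suc a} u-ok = cons (s≤s z≤n) ≤-refl u-ok

largestPart-∷₊ : ∀ {a u} → Partition≤ a u → largestPart (a ∷₊ u) ≡ a
largestPart-∷₊ {zero}  _    = refl
largestPart-∷₊ {suc a} u-ok = largestPart-∷ (∷₊-Partition≤ u-ok)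

drop-∷₊ : ∀ {a u} → Partition≤ a u → drop 1 (a ∷₊ u) ≡ u
drop-∷₊ {zero}  u-ok = sym (Partition≤-zero u-ok)
drop-∷₊ {suc a} _    = refl

length-∷₊ : ∀ a u → length (a ∷₊ u) ≤ suc (length u)
length-∷₊ zero    u = z≤n
length-∷₊ (suc a) u = ≤-refl

largestPart-∷₊-drop : ∀ {k π} → Partition≤ k π → largestPart π ∷₊ drop 1 π ≡ π
largestPart-∷₊-drop []                                     = refl
largestPart-∷₊-drop π-ok@(cons {x = suc x} {xs} _ _ _) = cong (_∷₊ xs) (largestPart-∷ π-ok)

sum≡largestPart+sum-drop : ∀ {k π} → Partition≤ k π → sum π ≡ largestPart π + sum (drop 1 π)
sum≡largestPart+sum-drop []                        = refl
sum≡largestPart+sum-drop π-ok@(cons {xs = xs} _ _ _) = cong (_+ sum xs) (sym (largestPart-∷ π-ok))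

drop-Partition≤ : ∀ {k π} → Partition≤ k π → Partition≤ (largestPart π) (drop 1 π)
drop-Partition≤ []                            = []
drop-Partition≤ π-ok@(cons {xs = xs} _ _ ρ) = subst (λ j → Partition≤ j xs) (sym (largestPart-∷ π-ok)) ρ

rowToColumn : ℕ → List ℕ → List ℕ
rowToColumn m π = addFirstColumn (suc (largestPart π + m) ∸ length (drop 1 π)) (drop 1 π)

columnToRow : ℕ → List ℕ → List ℕ
columnToRow m μ = (length μ ∸ suc m) ∷₊ removeFirstColumn μ

module RowToColumn (m : ℕ) {k π} (π-ok : Partition≤ k π) (high-rank : ¬ RankAtMostMinus (3 + m) π) where

  length-drop≤ : length (drop 1 π) ≤ suc (largestPart π + m)
  length-drop≤ = begin
    length (drop 1 π) ≡⟨ length-drop 1 π ⟩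
    length π ∸ 1      ≤⟨ ∸-monoˡ-≤ 1 (s≤s⁻¹ length<) ⟩
    suc (largestPart π + m) ∎
    where
    open ≤-Reasoning
    length< : length π < 3 + (largestPart π + m)
    length< = subst (length π <_) (x∙yz≈y∙xz (largestPart π) 3 m) (≰⇒> high-rank)

  length-rowToColumn : length (rowToColumn m π) ≡ suc (largestPart π + m)
  length-rowToColumn = trans (length-addFirstColumn _ (drop 1 π)) (m+[n∸m]≡n length-drop≤)

  sum-rowToColumn : sum (rowToColumn m π) ≡ suc (m + sum π)
  sum-rowToColumn = begin
    sum (rowToColumn m π)
      ≡⟨ sum-addFirstColumn extra (drop 1 π) ⟩
    length (drop 1 π) + sum (drop 1 π) + extra
      ≡⟨ xy∙z≈y∙xz (length (drop 1 π)) (sum (drop 1 π)) extra ⟩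
    sum (drop 1 π) + (length (drop 1 π) + extra)
      ≡⟨ cong (_+_ (sum (drop 1 π))) (m+[n∸m]≡n length-drop≤) ⟩
    sum (drop 1 π) + suc (largestPart π + m)
      ≡⟨ regroup (sum (drop 1 π)) (largestPart π) m ⟩
    suc (m + (largestPart π + sum (drop 1 π)))
      ≡⟨ cong (λ s → suc (m + s)) (sum≡largestPart+sum-drop π-ok) ⟨
    suc (m + sum π) ∎
    where
    open ≡-Reasoning
    extra : ℕ
    extra = suc (largestPart π + m) ∸ length (drop 1 π)
    regroup : ∀ s h m → s + suc (h + m) ≡ suc (m + (h + s))
    regroup = solve-∀

  rowToColumn-Partition≤ : Partition≤ (suc (largestPart π)) (rowToColumn m π)
  rowToColumn-Partition≤ = addFirstColumn-Partition≤ _ (drop-Partition≤ π-ok)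

  rowToColumn-low-rank : RankAtMostMinus m (rowToColumn m π)
  rowToColumn-low-rank = begin
    largestPart (rowToColumn m π) + m ≤⟨ +-monoˡ-≤ m (largestPart-≤ rowToColumn-Partition≤) ⟩
    suc (largestPart π + m)           ≡⟨ length-rowToColumn ⟨
    length (rowToColumn m π)          ∎
    where open ≤-Reasoning

  columnToRow-rowToColumn : columnToRow m (rowToColumn m π) ≡ π
  columnToRow-rowToColumn = begin
    (length (rowToColumn m π) ∸ suc m) ∷₊ removeFirstColumn (rowToColumn m π)
      ≡⟨ cong₂ _∷₊_ (trans (cong (_∸ suc m) length-rowToColumn) (m+n∸n≡m (largestPart π) m))
                    (removeFirstColumn-addFirstColumn _ (drop-Partition≤ π-ok)) ⟩
    largestPart π ∷₊ drop 1 π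
      ≡⟨ largestPart-∷₊-drop π-ok ⟩
    π ∎
    where open ≡-Reasoning

module ColumnToRow (m N : ℕ) {k μ} (μ-ok : Partition≤ k μ) (Σμ : sum μ ≡ suc (m + N))
                   (low-rank : RankAtMostMinus m μ) where
  private
    u : List ℕ
    u = removeFirstColumn μ
    a : ℕ
    a = length μ ∸ suc m

  length-μ : length μ ≡ a + suc m
  length-μ = sym (m∸n+n≡m (≤-trans (+-monoˡ-≤ m 1≤largestPart) low-rank))
    where
    1≤largestPart : 1 ≤ largestPart μ
    1≤largestPart = largestPart-positive μ-ok (subst (0 <_) (sym Σμ) z<s)

  length-decomposition : length μ ≡ length u + countOnes μ
  length-decomposition = trans (cong length (first-column-decomposition μ-ok)) (length-addFirstColumn _ u)

  sum-decomposition : sum μ ≡ length u + sum u + countOnes μ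
  sum-decomposition = trans (cong sum (first-column-decomposition μ-ok)) (sum-addFirstColumn _ u)

  u-ok : Partition≤ a u
  u-ok = Partition≤-weaken (pred-mono-≤ largestPart≤1+a)
                           (removeFirstColumn-Partition≤ (Partition≤-largestPart μ-ok))
    where
    largestPart≤1+a : largestPart μ ≤ suc a
    largestPart≤1+a = +-cancelʳ-≤ m _ _ (subst (largestPart μ + m ≤_) (trans length-μ (+-suc a m)) low-rank)

  sum-columnToRow : sum (columnToRow m μ) ≡ N
  sum-columnToRow = begin
    sum (a ∷₊ u)
      ≡⟨ sum≡largestPart+sum-drop (∷₊-Partition≤ u-ok) ⟩
    largestPart (a ∷₊ u) + sum (drop 1 (a ∷₊ u))
      ≡⟨ cong₂ (λ h t → h + sum t) (largestPart-∷₊ u-ok) (drop-∷₊ u-ok) ⟩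
    a + sum u
      ≡⟨ +-cancelʳ-≡ (suc m) _ _ a+Σu+1+m≡N+1+m ⟩
    N ∎
    where
    open ≡-Reasoning
    a+Σu+1+m≡N+1+m : a + sum u + suc m ≡ N + suc m
    a+Σu+1+m≡N+1+m = begin
      a + sum u + suc m                ≡⟨ xy∙z≈y∙xz a (sum u) (suc m) ⟩
      sum u + (a + suc m)              ≡⟨ cong (_+_ (sum u)) (trans (sym length-μ) length-decomposition) ⟩
      sum u + (length u + countOnes μ) ≡⟨ x∙yz≈yx∙z (sum u) (length u) (countOnes μ) ⟩
      length u + sum u + countOnes μ   ≡⟨ trans (sym sum-decomposition) Σμ ⟩
      suc (m + N)                      ≡⟨ +-comm N (suc m) ⟨
      N + suc m                        ∎

  columnToRow-high-rank : ¬ RankAtMostMinus (3 + m) (columnToRow m μ)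
  columnToRow-high-rank low = 1+n≰n (begin
    suc (suc (a + suc m))          ≡⟨ trans (+-suc a _) (cong suc (+-suc a _)) ⟨
    a + (3 + m)                    ≡⟨ cong (_+ (3 + m)) (largestPart-∷₊ u-ok) ⟨
    largestPart (a ∷₊ u) + (3 + m) ≤⟨ low ⟩
    length (a ∷₊ u)                ≤⟨ length-∷₊ a u ⟩
    suc (length u)                 ≤⟨ s≤s (subst (length u ≤_) (sym length-decomposition) (m≤m+n _ _)) ⟩
    suc (length μ)                 ≡⟨ cong suc length-μ ⟩
    suc (a + suc m)                ∎)
    where open ≤-Reasoning

  rowToColumn-columnToRow : rowToColumn m (columnToRow m μ) ≡ μ
  rowToColumn-columnToRow = begin
    rowToColumn m (a ∷₊ u)
      ≡⟨ cong₂ (λ h t → addFirstColumn (suc (h + m) ∸ length t) t) (largestPart-∷₊ u-ok) (drop-∷₊ u-ok) ⟩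
    addFirstColumn (suc (a + m) ∸ length u) u
      ≡⟨ cong (λ r → addFirstColumn (r ∸ length u) u)
              (trans (sym (+-suc a m)) (trans (sym length-μ) length-decomposition)) ⟩
    addFirstColumn (length u + countOnes μ ∸ length u) u
      ≡⟨ cong (λ r → addFirstColumn r u) (m+n∸m≡n (length u) (countOnes μ)) ⟩
    addFirstColumn (countOnes μ) u
      ≡⟨ first-column-decomposition μ-ok ⟨
    μ ∎
    where open ≡-Reasoning

rowToColumn-InverseOn : ∀ m N → InverseOn (filter (∁? (rankAtMostMinus? (3 + m))) (partitions N))
                                          (filter (rankAtMostMinus? m) (partitions (suc (m + N))))
rowToColumn-InverseOn m N = record
  { to      = rowToColumn m
  ; from    = columnToRow m
  ; to-∈    = λ π∈ → let π∈P , high = ∈-filter⁻ (∁? (rankAtMostMinus? (3 + m))) π∈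
                         π-ok , Σπ = ∈-partitions⁻ {N} π∈P
                         open RowToColumn m π-ok high in
      ∈-filter⁺ (rankAtMostMinus? m)
        (∈-partitions⁺ rowToColumn-Partition≤ (trans sum-rowToColumn (cong (λ s → suc (m + s)) Σπ)))
        rowToColumn-low-rank
  ; from-∈  = λ μ∈ → let μ∈P , low = ∈-filter⁻ (rankAtMostMinus? m) μ∈
                         μ-ok , Σμ = ∈-partitions⁻ {suc (m + N)} μ∈P
                         open ColumnToRow m N μ-ok Σμ low in
      ∈-filter⁺ (∁? (rankAtMostMinus? (3 + m))) (∈-partitions⁺ (∷₊-Partition≤ u-ok) sum-columnToRow)
        columnToRow-high-rank
  ; from∘to = λ π∈ → let π∈P , high = ∈-filter⁻ (∁? (rankAtMostMinus? (3 + m))) π∈ in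
      RowToColumn.columnToRow-rowToColumn m (proj₁ (∈-partitions⁻ {N} π∈P)) high
  ; to∘from = λ μ∈ → let μ∈P , low = ∈-filter⁻ (rankAtMostMinus? m) μ∈
                         μ-ok , Σμ = ∈-partitions⁻ {suc (m + N)} μ∈P in
      ColumnToRow.rowToColumn-columnToRow m N μ-ok Σμ low
  }

rankAtMostMinusCount-recurrence : ∀ m N →
  rankAtMostMinusCount m (suc (m + N)) + rankAtMostMinusCount (3 + m) N ≡ partitionCount N
rankAtMostMinusCount-recurrence m N = begin
  rankAtMostMinusCount m (suc (m + N)) + rankAtMostMinusCount (3 + m) N
    ≡⟨ cong (_+ rankAtMostMinusCount (3 + m) N) (InverseOn-length
         (Unique.filter⁺ _ (partitions-unique N)) (Unique.filter⁺ _ (partitions-unique (suc (m + N))))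
         (rowToColumn-InverseOn m N)) ⟨
  #high-rank + rankAtMostMinusCount (3 + m) N
    ≡⟨ +-comm #high-rank _ ⟩
  rankAtMostMinusCount (3 + m) N + #high-rank
    ≡⟨ length≡filter+filter∁ (rankAtMostMinus? (3 + m)) (partitions N) ⟨
  partitionCount N ∎
  where
  open ≡-Reasoning
  #high-rank : ℕ
  #high-rank = length (filter (∁? (rankAtMostMinus? (3 + m))) (partitions N))

pMex≡rankAtMostMinusCount : ∀ M m → pMex 3 (4 + m) (+ M) ≡ rankAtMostMinusCount m (suc (m + M))
pMex≡rankAtMostMinusCount = <-rec Claim step
  where
  open ≡-Reasoning
  Claim : ℕ → Set
  Claim M = ∀ m → pMex 3 (4 + m) (+ M) ≡ rankAtMostMinusCount m (suc (m + M))
  step : ∀ M → (∀ {M′} → M′ < M → Claim M′) → Claim M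
  step M rec m with M <? 4 + m
  ... | yes M<4+m = begin
    pMex 3 (4 + m) (+ M)
      ≡⟨ pMex-below 3 (4 + m) M M<4+m ⟩
    partitionCount M
      ≡⟨ rankAtMostMinusCount-recurrence m M ⟨
    rankAtMostMinusCount m (suc (m + M)) + rankAtMostMinusCount (3 + m) M
      ≡⟨ cong (_+_ _) (rankAtMostMinusCount-vanishes (2 + m) M (s≤s⁻¹ M<4+m)) ⟩
    rankAtMostMinusCount m (suc (m + M)) + 0
      ≡⟨ +-identityʳ _ ⟩
    rankAtMostMinusCount m (suc (m + M)) ∎
  ... | no M≮4+m with m≤n⇒∃[o]m+o≡n (≮⇒≥ M≮4+m)
  ...   | M′ , refl = +-cancelʳ-≡ _ _ _ (begin
    pMex 3 (4 + m) (+ N) + pMex 3 (4 + m + 3) (+ M′)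
      ≡⟨ pMex-recurrence 3 (4 + m) M′ (s≤s z≤n) ⟩
    partitionCount N
      ≡⟨ rankAtMostMinusCount-recurrence m N ⟨
    rankAtMostMinusCount m (suc (m + N)) + rankAtMostMinusCount (3 + m) N
      ≡⟨ cong (_+_ _) shifted ⟨
    rankAtMostMinusCount m (suc (m + N)) + pMex 3 (4 + m + 3) (+ M′) ∎)
    where
    N : ℕ
    N = 4 + m + M′
    shifted : pMex 3 (4 + m + 3) (+ M′) ≡ rankAtMostMinusCount (3 + m) N
    shifted = trans (cong (λ c → pMex 3 (_+_ 4 c) (+ M′)) (+-comm m 3))
                    (rec (s≤s (m≤n+m M′ (3 + m))) (3 + m))

corollary5p2 : (n : ℕ) → 1 ≤ n → pMex 3 6 (+ n - + 3) ≡ gardenOfEdenCount n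
corollary5p2 1                   _ = refl
corollary5p2 2                   _ = refl
corollary5p2 (suc (suc (suc M))) _ =
  trans (pMex≡rankAtMostMinusCount M 2) (sym (gardenOfEdenCount≡rankAtMostMinusCount (3 + M)))
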